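{- Let $P$ be a finite bounded poset of rank $k$ with a $CL$-labeling $\lambda$, and let $\Sigma_1,\dots,\Sigma_m$ be a $CL$-ced of $P$ with respect to $\lambda$, with associated complexes $\Delta_1,\dots,\Delta_m$. Let $\mathbf{c}=\{x\lessdot c_1\lessdot\dots\lessdot c_{j-1}\lessdot y\}$ be a maximal chain on a rooted interval $[x,y]_{\mathbf r}$ such that $\mathbf c$ is a face of $\Delta_s$, and suppose $\mathbf c$ has an ascent at $c_i$. Then $\Delta_s$ contains a chain $\mathbf c''=(\mathbf c\setminus\{c_i\})\cup\{c_i''\}$ which has a descent at $c_i''$ and is lexicographically later than $\mathbf c$.
   Context: A cover relation $x\lessdot y$ means $x<y$ with nothing strictly between. A rooted cover relation is a pair $(\mathbf r,x\lessdot y)$ with $\mathbf r$ a maximal chain from $\hat0$ to $x$; for a maximal chain $x_0\lessdot x_1\lessdot\dots\lessdot x_n$ with root $\mathbf r$ for $x_0\lessdot x_1$, the roots of later edges are $\mathbf r\cup\{x_1\}$, etc., giving a rooted chain on a rooted interval $[x_0,x_n]_{\mathbf r}$. A $CL$-labeling assigns to each rooted cover relation an element of a fixed poset of labels such that in every rooted interval there is a unique maximal chain whose labels (read from the bottom) are weakly increasing, and it is lexicographically first among maximal chains of that rooted interval. A chain has an ascent at $c_i$ if the label of the edge below $c_i$ is $\le$ the label of the edge above $c_i$, a descent otherwise; a chain is descending if it has no ascents. Given an ordered collection $\Sigma_1,\dots,\Sigma_m$ of rank-$k$ subposets of $P$, $\Delta_s$ is the simplicial complex generated by maximal chains of $P$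 lying in $\Sigma_s$ but in no $\Sigma_t$, $t<s$; $\mathcal M(X)$ denotes the set of maximal chains. The collection is a $CL$-ced with respect to $\lambda$ if: (polytope) each $\Sigma_s$ is isomorphic to the face lattice of a convex polytope; (desc) for each $s$ and each rooted interval $[x,y]_{\mathbf r}$ of $P$ there is at most one descending maximal chain on $[x,y]_{\mathbf r}$ which is a face of $\Delta_s$; (bdry) if $\mathbf c$ is a chain of length $<k$ that extends to maximal chains in both $\Delta_s$ and $\Delta_t$ with $t<s$, then $\mathbf c$ extends to a chain in $\mathcal M(\Sigma_s)\setminus\mathcal M(\Delta_s)$; (union) every chain of $P$ lies in some $\Sigma_s$. -}

module Defs where

open import Level using (0ℓ)
open import Data.Nat using (ℕ; zero; suc) renaming (_<_ to _<ℕ_)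
open import Data.Fin using (Fin) renaming (_<_ to _<ᶠ_)
open import Data.Fin.Subset using (Subset; _∈_; _⊆_)
open import Data.List using (List; []; _∷_; _++_; length)
open import Data.List.Relation.Unary.All using (All)
open import Data.List.Relation.Unary.Linked using (Linked)
open import Data.List.Membership.Propositional using () renaming (_∈_ to _∈ᴸ_)
open import Data.Product using (Σ; ∃; _×_; _,_)
open import Data.Sum using (_⊎_)
open import Relation.Nullary using (¬_)
open import Relation.Binary.PropositionalEquality using (_≡_; _≢_)
open import Relation.Binary.Structures using (IsPartialOrder; IsTotalOrder)
open import Relation.Binary.Bundles using (Poset)
open import Algebra.Structures using (IsCommutativeRing)

record FinBoundedPoset : Set₁ where
  field
    N              : ℕ
    _≤_            : Fin N → Fin N → Set
    isPartialOrder : IsPartialOrder _≡_ _≤_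
    𝟘 𝟙            : Fin N
    𝟘-least        : ∀ p → 𝟘 ≤ p
    𝟙-greatest     : ∀ p → p ≤ 𝟙

-- Ordered fields (used to speak about convex polytopes without ℝ).

record OrderedField : Set₁ where
  field
    Carrier           : Set
    _+_ _*_           : Carrier → Carrier → Carrier
    -_                : Carrier → Carrier
    0# 1#             : Carrier
    _≤_               : Carrier → Carrier → Set
    isCommutativeRing : IsCommutativeRing _≡_ _+_ _*_ -_ 0# 1#
    0≢1               : 0# ≢ 1#
    inverse           : ∀ a → a ≢ 0# → ∃ λ b → (a * b) ≡ 1#
    isTotalOrder      : IsTotalOrder _≡_ _≤_
    +-mono            : ∀ a b c → a ≤ b → (a + c) ≤ (b + c)
    *-nonneg          : ∀ a b → 0# ≤ a → 0# ≤ b → 0# ≤ (a * b)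

module Polytope (F : OrderedField) where
  open OrderedField F

  ∑ : ∀ {d} → (Fin d → Carrier) → Carrier
  ∑ {zero}  f = 0#
  ∑ {suc d} f = f Fin.zero + ∑ (λ i → f (Fin.suc i))

  dot : ∀ {d} → (Fin d → Carrier) → (Fin d → Carrier) → Carrier
  dot a v = ∑ (λ i → a i * v i)

  -- For the polytope conv{V 0,…,V (n-1)} ⊆ F^d, a face is P ∩ H for a
  -- supporting hyperplane H = {a·x = b} (a·x ≤ b on P; a = 0 allowed, giving
  -- P itself and ∅).  A face is determined by (and is the convex hull of) the
  -- points V i lying on it, so faces are recorded as subsets of Fin n and the
  -- face lattice is this family of subsets ordered by inclusion.
  IsFace : ∀ {d n} → (Fin n → Fin d → Carrier) → Subset n → Set
  IsFace {d} {n} V S =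
    Σ (Fin d → Carrier) λ a → Σ Carrier λ b →
      (∀ i → dot a (V i) ≤ b) ×
      (∀ i → (i ∈ S → dot a (V i) ≡ b) × (dot a (V i) ≡ b → i ∈ S))

module Chains (P : FinBoundedPoset) where
  open FinBoundedPoset P

  Elt : Set
  Elt = Fin N

  _<_ : Elt → Elt → Set
  x < y = (x ≤ y) × (x ≢ y)

  _⋖_ : Elt → Elt → Set
  x ⋖ y = (x < y) × ¬ (∃ λ z → (x < z) × (z < y))

  IsChain : List Elt → Set
  IsChain = Linked _<_

  Comparable : Elt → Elt → Set
  Comparable w z = (w ≤ z) ⊎ (z ≤ w)

  IsMaxChain : List Elt → Set
  IsMaxChain zs = IsChain zs × (∀ w → All (Comparable w) zs → w ∈ᴸ zs)

  IsMaxChainIn : Subset N → List Elt → Set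
  IsMaxChainIn S zs =
    All (_∈ S) zs × IsChain zs × (∀ w → w ∈ S → All (Comparable w) zs → w ∈ᴸ zs)

  -- P has rank k: every maximal chain has length k (i.e. k+1 elements)
  HasRank : ℕ → Set
  HasRank k = ∀ zs → IsMaxChain zs → length zs ≡ suc k

  SubHasRank : Subset N → ℕ → Set
  SubHasRank S k = ∀ zs → IsMaxChainIn S zs → length zs ≡ suc k

  -- CoverSeq x zs y : x ⋖ z₁ ⋖ … ⋖ z_j = y where zs = z₁ … z_j
  -- (a maximal chain x ∪ zs on the interval [x,y]; zs = [] means x = y)
  CoverSeq : Elt → List Elt → Elt → Set
  CoverSeq x []       y = x ≡ y
  CoverSeq x (z ∷ zs) y = (x ⋖ z) × CoverSeq z zs y

  IsRoot : List Elt → Elt → Set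
  IsRoot ρ x = CoverSeq 𝟘 ρ x

  _⊆ᴸ_ : List Elt → List Elt → Set
  c ⊆ᴸ M = All (_∈ᴸ M) c

  -- Σ_S is isomorphic (as a poset, with the order induced from P) to the face
  -- lattice of a convex polytope (over some ordered field).
  IsPolytopal : Subset N → Set₁
  IsPolytopal S =
    Σ OrderedField λ F → Σ ℕ λ d → Σ ℕ λ n →
    Σ (Fin n → Fin d → OrderedField.Carrier F) λ V →
    Σ (Elt → Subset n) λ f →
      (∀ p → p ∈ S → Polytope.IsFace F V (f p)) ×
      (∀ p q → p ∈ S → q ∈ S → f p ≡ f q → p ≡ q) ×
      (∀ T → Polytope.IsFace F V T → ∃ λ p → (p ∈ S) × (f p ≡ T)) ×
      (∀ p q → p ∈ S → q ∈ S → ((p ≤ q) → (f p ⊆ f q)) × ((f p ⊆ f q) → (p ≤ q)))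

-- Labelings.  A labeling assigns to a rooted cover relation (ρ, x ⋖ z),
-- where ρ is the root of x, the label lab ρ z (x is determined by ρ).

module Labelled (P : FinBoundedPoset) (L : Poset 0ℓ 0ℓ 0ℓ)
                (lab : List (Fin (FinBoundedPoset.N P)) → Fin (FinBoundedPoset.N P) → Poset.Carrier L) where
  open FinBoundedPoset P using (𝟘; 𝟙) renaming (_≤_ to _≤P_)
  open Chains P
  open Poset L using (Carrier) renaming (_≤_ to _⊑_; _≈_ to _≈_)

  labels : List Elt → List Elt → List Carrier
  labels ρ []       = []
  labels ρ (z ∷ zs) = lab ρ z ∷ labels (ρ ++ (z ∷ [])) zs

  _⊏_ : Carrier → Carrier → Set
  a ⊏ b = (a ⊑ b) × ¬ (a ≈ b)

  WeaklyIncreasing : List Carrier → Set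
  WeaklyIncreasing = Linked _⊑_

  DescendingLabels : List Carrier → Set
  DescendingLabels = Linked (λ a b → ¬ (a ⊑ b))

  data LexLt : List Carrier → List Carrier → Set where
    here  : ∀ {a b as bs} → a ⊏ b → LexLt (a ∷ as) (b ∷ bs)
    there : ∀ {a b as bs} → a ≈ b → LexLt as bs → LexLt (a ∷ as) (b ∷ bs)

  IsCLLabeling : Set
  IsCLLabeling =
    ∀ x y ρ → IsRoot ρ x → x ≤P y →
      Σ (List Elt) λ zs →
        CoverSeq x zs y × WeaklyIncreasing (labels ρ zs) ×
        (∀ ws → CoverSeq x ws y → WeaklyIncreasing (labels ρ ws) → ws ≡ zs) ×
        (∀ ws → CoverSeq x ws y → ws ≢ zs → LexLt (labels ρ zs) (labels ρ ws))

  module CED (k m : ℕ) (Σs : Fin m → Subset (FinBoundedPoset.N P)) where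

    -- generating maximal chains of Δ_s: maximal chains of P in Σ_s and in
    -- no Σ_t with t < s
    Gen : Fin m → List Elt → Set
    Gen s M = IsMaxChain M × All (_∈ Σs s) M ×
              (∀ t → t <ᶠ s → ¬ All (_∈ Σs t) M)

    FaceΔ : Fin m → List Elt → Set
    FaceΔ s c = ∃ λ M → Gen s M × (c ⊆ᴸ M)

    MΣ : Fin m → List Elt → Set
    MΣ s M = IsMaxChain M × All (_∈ Σs s) M

    MΔ : Fin m → List Elt → Set
    MΔ s M = IsMaxChain M × FaceΔ s M

    record IsCLced : Set₁ where
      field
        rank     : ∀ s → SubHasRank (Σs s) k
        polytope : ∀ s → IsPolytopal (Σs s)
        desc     : ∀ s x y ρ → IsRoot ρ x → ∀ zs ws →
                   CoverSeq x zs y → CoverSeq x ws y →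
                   DescendingLabels (labels ρ zs) → DescendingLabels (labels ρ ws) →
                   FaceΔ s (x ∷ zs) → FaceΔ s (x ∷ ws) → zs ≡ ws
        bdry     : ∀ s t c → IsChain c → length c <ℕ suc k → t <ᶠ s →
                   (∃ λ M → MΔ s M × (c ⊆ᴸ M)) → (∃ λ M → MΔ t M × (c ⊆ᴸ M)) →
                   ∃ λ M → MΣ s M × ¬ MΔ s M × (c ⊆ᴸ M)
        union    : ∀ c → IsChain c → ∃ λ s → All (_∈ Σs s) c

-- Write a ⋖ cᵢ ⋖ d for the part of c around cᵢ and M for a generating chain of Δ_s containing c.
-- Since Σ_s is the face lattice of a polytope, its length-two interval [a, d] is a diamond, so
-- it contains some e ≠ cᵢ; as P is graded, exchanging cᵢ for e in M gives a maximal chain M′.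
-- M′ lies in no earlier Σ_t: for the least such t, the diamond of Σ_t would give two distinct
-- exchanges, both generating Δ_t and both descending on [a, d]_ρ (the ascending a ⋖ cᵢ ⋖ d is
-- the unique increasing chain there), against (desc). So M′ generates Δ_s, and by the CL property
-- a ⋖ e ⋖ d is a descent lexicographically after a ⋖ cᵢ ⋖ d. Only (polytope) and (desc) are used.
-- The diamond property comes from combining the supporting hyperplanes of faces F ⊂ G ⊂ H into
-- one whose face lies between F and H and is incomparable with G.

module Submission where

open import Defs
open import Level using (0ℓ)
open import Data.Nat using (ℕ)
open import Data.Fin using (Fin)
open import Data.Fin.Subset using (Subset)
open import Data.List using (List; []; _∷_; _++_)
open import Data.Product using (∃; _×_; _,_)
open import Relation.Nullary using (¬_)
open import Relation.Binary.Bundles using (Poset)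

open import Algebra.Bundles using (CommutativeRing)
import Algebra.Properties.CommutativeSemigroup as CommutativeSemigroupProperties
import Algebra.Properties.Group as GroupProperties
import Algebra.Properties.Ring as RingProperties
open import Data.Empty using (⊥; ⊥-elim)
open import Data.Fin using (zero; suc; _≟_) renaming (_<_ to _<ᶠ_)
open import Data.Fin.Induction using () renaming (<-wellFounded to <ᶠ-wellFounded)
import Data.Fin.Properties as Fin
open import Data.Fin.Properties using (any?; injective⇒≤)
open import Data.Fin.Subset using (_∈_; _∉_; _⊆_; _⊈_; _⊂_)
open import Data.Fin.Subset.Properties using (_∈?_; _⊆?_; ⊆-antisym)
open import Data.List using (length; lookup; filter)
open import Data.List.Membership.Propositional using () renaming (_∈_ to _∈ᴸ_; _∉_ to _∉ᴸ_)
open import Data.List.Membership.Propositional.Properties using (∈-lookup; ∈-filter⁺; ∈-filter⁻)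
import Data.List.Membership.DecPropositional as DecMembership
open import Data.List.Properties using (filter-all; ++-identityʳ; ++-assoc; ∷-injectiveˡ)
open import Data.List.Relation.Unary.All using (All; []; _∷_)
import Data.List.Relation.Unary.All as All
import Data.List.Relation.Unary.All.Properties as Allₚ
open import Data.List.Relation.Unary.AllPairs using (AllPairs; []; _∷_)
import Data.List.Relation.Unary.AllPairs as AllPairs
import Data.List.Relation.Unary.AllPairs.Properties as AllPairsₚ
open import Data.List.Relation.Unary.Any using (here; there)
open import Data.List.Relation.Unary.Linked using ([-]; _∷_)
open import Data.List.Relation.Unary.Linked.Properties using (AllPairs⇒Linked; Linked⇒AllPairs)
open import Data.Nat using (zero; suc)
import Data.Nat as ℕ
import Data.Nat.Properties as ℕ
open import Data.Product using (Σ; proj₁; proj₂; uncurry)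
open import Data.Sum using (_⊎_; inj₁; inj₂; [_,_]′; map₂)
open import Data.Vec using (tabulate)
open import Data.Vec.Properties using (lookup∘tabulate; []=⇒lookup; lookup⇒[]=)
open import Function using (_∘_; flip)
open import Function.Definitions using (Injective)
import Induction.WellFounded as WellFounded
open import Relation.Binary.PropositionalEquality
  using (_≡_; _≢_; refl; sym; trans; cong; cong₂; subst; subst₂; module ≡-Reasoning)
open import Relation.Binary.Structures using (IsTotalOrder; IsPartialOrder)
open import Relation.Nullary using (Dec; yes; no; does; ¬?; ¬¬-excluded-middle)
open import Relation.Nullary.Decidable using (dec-true; _×-dec_; decidable-stable)
open import Relation.Nullary.Negation using (¬¬-map)
open import Relation.Unary using (Pred; Decidable)

¬¬-decidable : ∀ {n} (Q : Pred (Fin n) 0ℓ) → ¬ ¬ Decidable Q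
¬¬-decidable {zero}  Q k = k λ ()
¬¬-decidable {suc n} Q k = ¬¬-decidable (Q ∘ suc) λ Q∘suc? →
  ¬¬-excluded-middle λ Q0? → k λ { zero → Q0? ; (suc i) → Q∘suc? i }

subsetOf : ∀ {n} {Q : Pred (Fin n) 0ℓ} → Decidable Q → Subset n
subsetOf Q? = tabulate (does ∘ Q?)

∈-subsetOf⁻ : ∀ {n} {Q : Pred (Fin n) 0ℓ} (Q? : Decidable Q) {i} → i ∈ subsetOf Q? → Q i
∈-subsetOf⁻ Q? {i} i∈ with Q? i | trans (sym (lookup∘tabulate (does ∘ Q?) i)) ([]=⇒lookup i∈)
... | yes q | _ = q
... | no _  | ()

∈-subsetOf⁺ : ∀ {n} {Q : Pred (Fin n) 0ℓ} (Q? : Decidable Q) {i} → Q i → i ∈ subsetOf Q?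
∈-subsetOf⁺ Q? {i} q = lookup⇒[]= i _ (trans (lookup∘tabulate (does ∘ Q?) i) (dec-true (Q? i) q))

⊆∧≢⇒⊂ : ∀ {n} {A B : Subset n} → A ⊆ B → A ≢ B → A ⊂ B
⊆∧≢⇒⊂ {A = A} {B} A⊆B A≢B with any? (λ i → (i ∈? B) ×-dec ¬? (i ∈? A))
... | yes B∖A = A⊆B , B∖A
... | no  B∖A≡∅ = ⊥-elim (A≢B (⊆-antisym A⊆B B⊆A))
  where
  B⊆A : B ⊆ A
  B⊆A {i} i∈B with i ∈? A
  ... | yes i∈A = i∈A
  ... | no  i∉A = ⊥-elim (B∖A≡∅ (i , i∈B , i∉A))

module OrderedFieldProperties (F : OrderedField) where
  open OrderedField F public using (Carrier; inverse)
  open OrderedField F using (+-mono; *-nonneg; isTotalOrder) renaming (_≤_ to _≤′_)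

  -- Re-declared only to give it a fixity, so that x ≤ y - z parses.
  infix 4 _≤_
  _≤_ : Carrier → Carrier → Set
  _≤_ = _≤′_

  commutativeRing : CommutativeRing 0ℓ 0ℓ
  commutativeRing = record { isCommutativeRing = OrderedField.isCommutativeRing F }

  open CommutativeRing commutativeRing public using (_+_; _*_; -_; 0#; 1#)

  infixl 6 _-_
  _-_ : Carrier → Carrier → Carrier
  x - y = x + - y

  open IsTotalOrder isTotalOrder public using (total; antisym)
    renaming (refl to ≤-refl; trans to ≤-trans)
  open CommutativeRing commutativeRing public
    using (+-assoc; +-comm; +-identityˡ; +-identityʳ; *-identityˡ; *-identityʳ; zeroʳ; distribˡ; distribʳ; *-assoc)
  module +-commutativeSemigroup = CommutativeSemigroupProperties (CommutativeRing.+-commutativeSemigroup commutativeRing)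
  module *-commutativeSemigroup = CommutativeSemigroupProperties (CommutativeRing.*-commutativeSemigroup commutativeRing)
  open GroupProperties (CommutativeRing.+-group commutativeRing) public
    using (x∙y⁻¹≈ε⇒x≈y; x≈y⇒x∙y⁻¹≈ε; //-rightDividesˡ; //-rightDividesʳ)
  open RingProperties (CommutativeRing.ring commutativeRing) public
    using ([y-z]x≈yx-zx; x[y-z]≈xy-xz; -‿distribˡ-*; -0#≈0#; -‿+-comm)

  x≤y⇒0≤y-x : ∀ {x y} → x ≤ y → 0# ≤ y - x
  x≤y⇒0≤y-x {x} {y} x≤y = subst (_≤ y - x) (x≈y⇒x∙y⁻¹≈ε refl) (+-mono x y (- x) x≤y)

  0≤y-x⇒x≤y : ∀ {x y} → 0# ≤ y - x → x ≤ y
  0≤y-x⇒x≤y {x} {y} 0≤y-x = subst₂ _≤_ (+-identityˡ x) (//-rightDividesˡ x y) (+-mono 0# (y - x) x 0≤y-x)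

  +-nonneg : ∀ {x y} → 0# ≤ x → 0# ≤ y → 0# ≤ x + y
  +-nonneg {x} {y} 0≤x 0≤y = ≤-trans 0≤y (0≤y-x⇒x≤y (subst (0# ≤_) (sym (//-rightDividesʳ y x)) 0≤x))

  *-monoʳ-≤-nonneg : ∀ {x y} z → 0# ≤ z → x ≤ y → x * z ≤ y * z
  *-monoʳ-≤-nonneg {x} {y} z 0≤z x≤y =
    0≤y-x⇒x≤y (subst (0# ≤_) ([y-z]x≈yx-zx z y x) (*-nonneg (y - x) z (x≤y⇒0≤y-x x≤y) 0≤z))

  nonneg-+≡0⇒≡0ʳ : ∀ {x y} → 0# ≤ x → 0# ≤ y → x + y ≡ 0# → y ≡ 0#
  nonneg-+≡0⇒≡0ʳ {x} {y} 0≤x 0≤y x+y≡0 = antisym (0≤y-x⇒x≤y (subst (0# ≤_) x≡0-y 0≤x)) 0≤y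
    where
    x≡0-y : x ≡ 0# - y
    x≡0-y = trans (sym (//-rightDividesʳ y x)) (cong (_- y) x+y≡0)

  x-0≡x : ∀ x → x - 0# ≡ x
  x-0≡x x = trans (cong (x +_) -0#≈0#) (+-identityʳ x)

  x+y*0≡x : ∀ x y → x + y * 0# ≡ x
  x+y*0≡x x y = trans (cong (x +_) (zeroʳ y)) (+-identityʳ x)

  divide : (x y : Carrier) → y ≢ 0# → Carrier
  divide x y y≢0 = x * proj₁ (inverse y y≢0)

  divide-*ʳ : ∀ x y (y≢0 : y ≢ 0#) → divide x y y≢0 * y ≡ x
  divide-*ʳ x y y≢0 = begin
    (x * y⁻¹) * y ≡⟨ *-commutativeSemigroup.xy∙z≈x∙zy x y⁻¹ y ⟩
    x * (y * y⁻¹) ≡⟨ cong (x *_) (proj₂ (inverse y y≢0)) ⟩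
    x * 1#        ≡⟨ *-identityʳ x ⟩
    x             ∎
    where
    open ≡-Reasoning
    y⁻¹ = proj₁ (inverse y y≢0)

  argmin : ∀ {n} {Q : Pred (Fin n) 0ℓ} → Decidable Q → (r : Fin n → Carrier) → ∃ Q →
           ∃ λ j → Q j × (∀ i → Q i → r j ≤ r i)
  argmin {suc n} Q? r (i₀ , q₀) with any? (Q? ∘ suc) | i₀
  ... | no none | zero  = zero , q₀ , λ { zero _ → ≤-refl ; (suc i) qi → ⊥-elim (none (i , qi)) }
  ... | no none | suc i = ⊥-elim (none (i , q₀))
  ... | yes ∃Q∘suc | _ with argmin (Q? ∘ suc) (r ∘ suc) ∃Q∘suc | Q? zero
  ...   | j , qj , min | no ¬q0 = suc j , qj , λ { zero q0 → ⊥-elim (¬q0 q0) ; (suc i) qi → min i qi }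
  ...   | j , qj , min | yes q0 with total (r zero) (r (suc j))
  ...     | inj₁ r0≤ = zero , q0 , λ { zero _ → ≤-refl ; (suc i) qi → ≤-trans r0≤ (min i qi) }
  ...     | inj₂ ≤r0 = suc j , qj , λ { zero _ → ≤r0 ; (suc i) qi → min i qi }

  upperBound : ∀ {n} (f : Fin n → Carrier) → ∃ λ K → ∀ i → f i ≤ K
  upperBound {zero}  f = 0# , λ ()
  upperBound {suc n} f with upperBound (f ∘ suc)
  ... | K , bound with total (f zero) K
  ...   | inj₁ f0≤K = K , λ { zero → f0≤K ; (suc i) → bound i }
  ...   | inj₂ K≤f0 = f zero , λ { zero → ≤-refl ; (suc i) → ≤-trans (bound i) K≤f0 }

module FaceGeometry (F : OrderedField) {d n : ℕ} (V : Fin n → Fin d → OrderedField.Carrier F) where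
  open OrderedFieldProperties F
  open Polytope F using (dot; IsFace)

  Halfspace : Set
  Halfspace = (Fin d → Carrier) × Carrier

  slack : Halfspace → Fin n → Carrier
  slack (a , b) i = b - dot a (V i)

  infixl 6 _+[_]_
  _+[_]_ : Halfspace → Carrier → Halfspace → Halfspace
  (a , b) +[ m ] (a′ , b′) = (λ k → a k + m * a′ k) , b + m * b′

  dot-+[] : ∀ {e} (a a′ v : Fin e → Carrier) m →
            dot (λ k → a k + m * a′ k) v ≡ dot a v + m * dot a′ v
  dot-+[] {zero}  a a′ v m = sym (x+y*0≡x 0# m)
  dot-+[] {suc e} a a′ v m = begin
    dot (λ k → a k + m * a′ k) v
      ≡⟨ cong₂ _+_ (trans (distribʳ (v zero) (a zero) (m * a′ zero))
                          (cong (a zero * v zero +_) (*-assoc m (a′ zero) (v zero))))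
                   (dot-+[] (a ∘ suc) (a′ ∘ suc) (v ∘ suc) m) ⟩
    (a zero * v zero + m * (a′ zero * v zero)) + (dot (a ∘ suc) (v ∘ suc) + m * dot (a′ ∘ suc) (v ∘ suc))
      ≡⟨ +-commutativeSemigroup.interchange (a zero * v zero) (m * (a′ zero * v zero)) _ _ ⟩
    (a zero * v zero + dot (a ∘ suc) (v ∘ suc)) + (m * (a′ zero * v zero) + m * dot (a′ ∘ suc) (v ∘ suc))
      ≡⟨ cong (dot a v +_) (sym (distribˡ m (a′ zero * v zero) _)) ⟩
    dot a v + m * dot a′ v ∎
    where
    open ≡-Reasoning

  slack-+[] : ∀ H m H′ i → slack (H +[ m ] H′) i ≡ slack H i + m * slack H′ i
  slack-+[] (a , b) m (a′ , b′) i = begin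
    (b + m * b′) - dot (λ k → a k + m * a′ k) (V i)  ≡⟨ cong (λ t → (b + m * b′) - t) (dot-+[] a a′ (V i) m) ⟩
    (b + m * b′) + - (A + m * A′)                   ≡⟨ cong ((b + m * b′) +_) (sym (-‿+-comm A (m * A′))) ⟩
    (b + m * b′) + (- A + - (m * A′))               ≡⟨ +-commutativeSemigroup.interchange b (m * b′) (- A) (- (m * A′)) ⟩
    (b - A) + (m * b′ - m * A′)                     ≡⟨ cong ((b - A) +_) (sym (x[y-z]≈xy-xz m b′ A′)) ⟩
    (b - A) + m * (b′ - A′)                         ∎
    where
    open ≡-Reasoning
    A = dot a (V i)
    A′ = dot a′ (V i)

  halfspace : ∀ {S} → IsFace V S → Halfspace
  halfspace (a , b , _) = a , b

  slack-nonneg : ∀ {S} (φ : IsFace V S) i → 0# ≤ slack (halfspace φ) i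
  slack-nonneg (_ , _ , supporting , _) i = x≤y⇒0≤y-x (supporting i)

  ∈⇒slack≡0 : ∀ {S} (φ : IsFace V S) {i} → i ∈ S → slack (halfspace φ) i ≡ 0#
  ∈⇒slack≡0 (_ , _ , _ , onFace) {i} i∈S = x≈y⇒x∙y⁻¹≈ε (sym (proj₁ (onFace i) i∈S))

  slack≡0⇒∈ : ∀ {S} (φ : IsFace V S) {i} → slack (halfspace φ) i ≡ 0# → i ∈ S
  slack≡0⇒∈ (_ , b , _ , onFace) {i} slack≡0 = proj₂ (onFace i) (sym (x∙y⁻¹≈ε⇒x≈y b _ slack≡0))

  ¬¬-zeroSet-face : ∀ H → (∀ i → 0# ≤ slack H i) →
    ¬ ¬ (Σ (Subset n) λ T → IsFace V T ×
           (∀ {i} → i ∈ T → slack H i ≡ 0#) × (∀ {i} → slack H i ≡ 0# → i ∈ T))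
  ¬¬-zeroSet-face H@(a , b) nonneg noFace = ¬¬-decidable (λ i → slack H i ≡ 0#) λ zero? →
    noFace (subsetOf zero? , (a , b , supporting , onFace zero?) , ∈-subsetOf⁻ zero? , ∈-subsetOf⁺ zero?)
    where
    supporting : ∀ i → dot a (V i) ≤ b
    supporting i = 0≤y-x⇒x≤y (nonneg i)
    onFace : (zero? : Decidable (λ i → slack H i ≡ 0#)) → ∀ i →
             (i ∈ subsetOf zero? → dot a (V i) ≡ b) × (dot a (V i) ≡ b → i ∈ subsetOf zero?)
    onFace zero? i = (λ i∈T → sym (x∙y⁻¹≈ε⇒x≈y b _ (∈-subsetOf⁻ zero? i∈T)))
                   , (λ on → ∈-subsetOf⁺ zero? (x≈y⇒x∙y⁻¹≈ε (sym on)))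

  -- x / y off S; the value 0 on S is junk, as y may vanish there.
  quotientOff : (S : Subset n) (x y : Fin n → Carrier) → (∀ {i} → i ∉ S → y i ≢ 0#) → Fin n → Carrier
  quotientOff S x y y≢0 i with i ∈? S
  ... | yes _   = 0#
  ... | no  i∉S = divide (x i) (y i) (y≢0 i∉S)

  quotientOff-*ʳ : ∀ S x y (y≢0 : ∀ {i} → i ∉ S → y i ≢ 0#) {i} → i ∉ S → quotientOff S x y y≢0 i * y i ≡ x i
  quotientOff-*ʳ S x y y≢0 {i} i∉S with i ∈? S
  ... | yes i∈S = ⊥-elim (i∉S i∈S)
  ... | no  _   = divide-*ʳ (x i) (y i) _

  -- h = g₁ − μ g₂ + (K + 1) g₃ is ≥ 0 and cuts out a face between S₁ and S₃ incomparable with S₂: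
  -- with μ = min g₁/g₂ over S₃ ∖ S₂, h ≥ 0 on S₃ and h vanishes at the minimiser j ∉ S₂;
  -- with K ≥ μ g₂/g₃ off S₃, h > 0 there; and h = g₁ > 0 on S₂ ∖ S₁.
  module DiamondConstruction {S₁ S₂ S₃} (φ₁ : IsFace V S₁) (φ₂ : IsFace V S₂) (φ₃ : IsFace V S₃)
                             (S₁⊂S₂ : S₁ ⊂ S₂) (S₂⊂S₃ : S₂ ⊂ S₃) where
    g₁ g₂ g₃ : Fin n → Carrier
    g₁ = slack (halfspace φ₁)
    g₂ = slack (halfspace φ₂)
    g₃ = slack (halfspace φ₃)

    g≢0 : ∀ {S} (φ : IsFace V S) {i} → i ∉ S → slack (halfspace φ) i ≢ 0#
    g≢0 φ i∉S g≡0 = i∉S (slack≡0⇒∈ φ g≡0)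

    ratio : Fin n → Carrier
    ratio = quotientOff S₂ g₁ g₂ (g≢0 φ₂)

    minimiser : ∃ λ j → (j ∈ S₃ × j ∉ S₂) × (∀ i → i ∈ S₃ × i ∉ S₂ → ratio j ≤ ratio i)
    minimiser = argmin (λ i → (i ∈? S₃) ×-dec ¬? (i ∈? S₂)) ratio (proj₂ S₂⊂S₃)

    j : Fin n
    j = proj₁ minimiser

    j∉S₂ : j ∉ S₂
    j∉S₂ = proj₂ (proj₁ (proj₂ minimiser))

    μ : Carrier
    μ = ratio j

    μg₂≤g₁ : ∀ {i} → i ∈ S₃ → μ * g₂ i ≤ g₁ i
    μg₂≤g₁ {i} i∈S₃ with i ∈? S₂
    ... | yes i∈S₂ = subst (_≤ g₁ i) (sym (trans (cong (μ *_) (∈⇒slack≡0 φ₂ i∈S₂)) (zeroʳ μ)))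
                          (slack-nonneg φ₁ i)
    ... | no  i∉S₂ = subst (μ * g₂ i ≤_) (quotientOff-*ʳ S₂ g₁ g₂ (g≢0 φ₂) i∉S₂)
                          (*-monoʳ-≤-nonneg (g₂ i) (slack-nonneg φ₂ i) (proj₂ (proj₂ minimiser) i (i∈S₃ , i∉S₂)))

    μg₂j≡g₁j : μ * g₂ j ≡ g₁ j
    μg₂j≡g₁j = quotientOff-*ʳ S₂ g₁ g₂ (g≢0 φ₂) j∉S₂

    bound : ∃ λ K → ∀ i → quotientOff S₃ (λ i → μ * g₂ i) g₃ (g≢0 φ₃) i ≤ K
    bound = upperBound (quotientOff S₃ (λ i → μ * g₂ i) g₃ (g≢0 φ₃))

    K : Carrier
    K = proj₁ bound

    μg₂≤Kg₃ : ∀ {i} → i ∉ S₃ → μ * g₂ i ≤ K * g₃ i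
    μg₂≤Kg₃ {i} i∉S₃ = subst (_≤ K * g₃ i) (quotientOff-*ʳ S₃ (λ i → μ * g₂ i) g₃ (g≢0 φ₃) i∉S₃)
      (*-monoʳ-≤-nonneg (g₃ i) (slack-nonneg φ₃ i) (proj₂ bound i))

    H : Halfspace
    H = halfspace φ₁ +[ - μ ] halfspace φ₂ +[ K ] halfspace φ₃ +[ 1# ] halfspace φ₃

    h : Fin n → Carrier
    h = slack H

    h≡ : ∀ i → h i ≡ ((g₁ i - μ * g₂ i) + K * g₃ i) + 1# * g₃ i
    h≡ i = begin
      h i
        ≡⟨ slack-+[] _ 1# _ i ⟩
      slack (halfspace φ₁ +[ - μ ] halfspace φ₂ +[ K ] halfspace φ₃) i + 1# * g₃ i
        ≡⟨ cong (_+ 1# * g₃ i) (slack-+[] _ K _ i) ⟩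
      (slack (halfspace φ₁ +[ - μ ] halfspace φ₂) i + K * g₃ i) + 1# * g₃ i
        ≡⟨ cong (λ t → (t + K * g₃ i) + 1# * g₃ i) (slack-+[] _ (- μ) _ i) ⟩
      ((g₁ i + - μ * g₂ i) + K * g₃ i) + 1# * g₃ i
        ≡⟨ cong (λ t → ((g₁ i + t) + K * g₃ i) + 1# * g₃ i) (sym (-‿distribˡ-* μ (g₂ i))) ⟩
      ((g₁ i - μ * g₂ i) + K * g₃ i) + 1# * g₃ i ∎
      where open ≡-Reasoning

    h-inside : ∀ {i} → i ∈ S₃ → h i ≡ g₁ i - μ * g₂ i
    h-inside {i} i∈S₃ = begin
      h i                                        ≡⟨ h≡ i ⟩
      ((g₁ i - μ * g₂ i) + K * g₃ i) + 1# * g₃ i ≡⟨ cong (λ t → ((g₁ i - μ * g₂ i) + K * t) + 1# * t) g₃i≡0 ⟩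
      ((g₁ i - μ * g₂ i) + K * 0#) + 1# * 0#     ≡⟨ x+y*0≡x _ 1# ⟩
      (g₁ i - μ * g₂ i) + K * 0#                 ≡⟨ x+y*0≡x _ K ⟩
      g₁ i - μ * g₂ i                            ∎
      where
      open ≡-Reasoning
      g₃i≡0 = ∈⇒slack≡0 φ₃ i∈S₃

    h-onS₂ : ∀ {i} → i ∈ S₂ → h i ≡ g₁ i
    h-onS₂ {i} i∈S₂ = trans (h-inside (proj₁ S₂⊂S₃ i∈S₂))
      (trans (cong (λ t → g₁ i - μ * t) (∈⇒slack≡0 φ₂ i∈S₂))
             (trans (cong (λ t → g₁ i - t) (zeroʳ μ)) (x-0≡x (g₁ i))))

    h-outside : ∀ {i} → i ∉ S₃ → h i ≡ (g₁ i + (K * g₃ i - μ * g₂ i)) + g₃ i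
    h-outside {i} _ = begin
      h i                                        ≡⟨ h≡ i ⟩
      ((g₁ i - μ * g₂ i) + K * g₃ i) + 1# * g₃ i ≡⟨ cong₂ _+_ (+-assoc (g₁ i) _ _) (*-identityˡ (g₃ i)) ⟩
      (g₁ i + (- (μ * g₂ i) + K * g₃ i)) + g₃ i  ≡⟨ cong (λ t → (g₁ i + t) + g₃ i) (+-comm _ (K * g₃ i)) ⟩
      (g₁ i + (K * g₃ i - μ * g₂ i)) + g₃ i      ∎
      where open ≡-Reasoning

    outside-nonneg : ∀ {i} → i ∉ S₃ → 0# ≤ g₁ i + (K * g₃ i - μ * g₂ i)
    outside-nonneg i∉S₃ = +-nonneg (slack-nonneg φ₁ _) (x≤y⇒0≤y-x (μg₂≤Kg₃ i∉S₃))

    h-nonneg : ∀ i → 0# ≤ h i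
    h-nonneg i with i ∈? S₃
    ... | yes i∈S₃ = subst (0# ≤_) (sym (h-inside i∈S₃)) (x≤y⇒0≤y-x (μg₂≤g₁ i∈S₃))
    ... | no  i∉S₃ = subst (0# ≤_) (sym (h-outside i∉S₃)) (+-nonneg (outside-nonneg i∉S₃) (slack-nonneg φ₃ i))

    h≡0⇒∈S₃ : ∀ {i} → h i ≡ 0# → i ∈ S₃
    h≡0⇒∈S₃ {i} h≡0 with i ∈? S₃
    ... | yes i∈S₃ = i∈S₃
    ... | no  i∉S₃ = ⊥-elim (g≢0 φ₃ i∉S₃
          (nonneg-+≡0⇒≡0ʳ (outside-nonneg i∉S₃) (slack-nonneg φ₃ i) (trans (sym (h-outside i∉S₃)) h≡0)))

    h-zeroOnS₁ : ∀ {i} → i ∈ S₁ → h i ≡ 0#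
    h-zeroOnS₁ i∈S₁ = trans (h-onS₂ (proj₁ S₁⊂S₂ i∈S₁)) (∈⇒slack≡0 φ₁ i∈S₁)

    h-zeroAt-j : h j ≡ 0#
    h-zeroAt-j = trans (h-inside (proj₁ (proj₁ (proj₂ minimiser)))) (x≈y⇒x∙y⁻¹≈ε (sym μg₂j≡g₁j))

    i₁ : Fin n
    i₁ = proj₁ (proj₂ S₁⊂S₂)

    i₁∈S₂ : i₁ ∈ S₂
    i₁∈S₂ = proj₁ (proj₂ (proj₂ S₁⊂S₂))

    h-nonzeroAt-i₁ : h i₁ ≢ 0#
    h-nonzeroAt-i₁ h≡0 = proj₂ (proj₂ (proj₂ S₁⊂S₂)) (slack≡0⇒∈ φ₁ (trans (sym (h-onS₂ i₁∈S₂)) h≡0))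

  face-diamond : ∀ {S₁ S₂ S₃} → IsFace V S₁ → IsFace V S₂ → IsFace V S₃ → S₁ ⊂ S₂ → S₂ ⊂ S₃ →
                 ¬ ¬ (∃ λ T → IsFace V T × S₁ ⊆ T × T ⊆ S₃ × T ⊈ S₂ × S₂ ⊈ T)
  face-diamond φ₁ φ₂ φ₃ S₁⊂S₂ S₂⊂S₃ noFace = ¬¬-zeroSet-face H h-nonneg λ (T , φ , T⇒h≡0 , h≡0⇒T) →
    noFace (T , φ , h≡0⇒T ∘ h-zeroOnS₁ , h≡0⇒∈S₃ ∘ T⇒h≡0
           , (λ T⊆S₂ → j∉S₂ (T⊆S₂ (h≡0⇒T h-zeroAt-j)))
           , (λ S₂⊆T → h-nonzeroAt-i₁ (T⇒h≡0 (S₂⊆T i₁∈S₂))))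
    where open DiamondConstruction φ₁ φ₂ φ₃ S₁⊂S₂ S₂⊂S₃

module ChainProperties (P : FinBoundedPoset) where
  open FinBoundedPoset P
  open Chains P
  private module ≤ = IsPartialOrder isPartialOrder
  open DecMembership (_≟_ {N}) using () renaming (_∈?_ to _∈ᴸ?_)

  <-trans : ∀ {x y z} → x < y → y < z → x < z
  <-trans (x≤y , x≢y) (y≤z , _) = ≤.trans x≤y y≤z , λ { refl → x≢y (≤.antisym x≤y y≤z) }

  ≤-<-trans : ∀ {x y z} → x ≤ y → y < z → x < z
  ≤-<-trans x≤y (y≤z , y≢z) = ≤.trans x≤y y≤z , λ { refl → y≢z (≤.antisym y≤z x≤y) }

  <⇒≱ : ∀ {x y} → x < y → ¬ (y ≤ x)
  <⇒≱ (x≤y , x≢y) y≤x = x≢y (≤.antisym x≤y y≤x)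

  Chain : List Elt → Set
  Chain = AllPairs _<_

  Linked⇒Chain : ∀ {C} → IsChain C → Chain C
  Linked⇒Chain = Linked⇒AllPairs <-trans

  chain-trichotomy : ∀ {C u v} → Chain C → u ∈ᴸ C → v ∈ᴸ C → u ≡ v ⊎ u < v ⊎ v < u
  chain-trichotomy (_   ∷ _)  (here refl) (here refl) = inj₁ refl
  chain-trichotomy (x<C ∷ _)  (here refl) (there v∈C) = inj₂ (inj₁ (All.lookup x<C v∈C))
  chain-trichotomy (x<C ∷ _)  (there u∈C) (here refl) = inj₂ (inj₂ (All.lookup x<C u∈C))
  chain-trichotomy (_   ∷ ch) (there u∈C) (there v∈C) = chain-trichotomy ch u∈C v∈C

  insert : (w : Elt) (C : List Elt) → All (Comparable w) C → List Elt
  insert w []      []              = w ∷ []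
  insert w (c ∷ C) (inj₁ _ ∷ _)    = w ∷ c ∷ C
  insert w (c ∷ C) (inj₂ _ ∷ w~C)  = c ∷ insert w C w~C

  length-insert : ∀ w C w~C → length (insert w C w~C) ≡ suc (length C)
  length-insert w []      []             = refl
  length-insert w (c ∷ C) (inj₁ _ ∷ _)   = refl
  length-insert w (c ∷ C) (inj₂ _ ∷ w~C) = cong suc (length-insert w C w~C)

  ∈-insert⁻ : ∀ {u} w C w~C → u ∈ᴸ insert w C w~C → u ≡ w ⊎ u ∈ᴸ C
  ∈-insert⁻ w []      []             (here u≡w)  = inj₁ u≡w
  ∈-insert⁻ w (c ∷ C) (inj₁ _ ∷ _)   (here u≡w)  = inj₁ u≡w
  ∈-insert⁻ w (c ∷ C) (inj₁ _ ∷ _)   (there u∈C) = inj₂ u∈C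
  ∈-insert⁻ w (c ∷ C) (inj₂ _ ∷ _)   (here u≡c)  = inj₂ (here u≡c)
  ∈-insert⁻ w (c ∷ C) (inj₂ _ ∷ w~C) (there u∈) = map₂ there (∈-insert⁻ w C w~C u∈)

  ∈-insert⁺ : ∀ {u} w C w~C → u ∈ᴸ C → u ∈ᴸ insert w C w~C
  ∈-insert⁺ w (c ∷ C) (inj₁ _ ∷ _)   u∈           = there u∈
  ∈-insert⁺ w (c ∷ C) (inj₂ _ ∷ _)   (here u≡c)   = here u≡c
  ∈-insert⁺ w (c ∷ C) (inj₂ _ ∷ w~C) (there u∈C)  = there (∈-insert⁺ w C w~C u∈C)

  insert-∈ : ∀ w C w~C → w ∈ᴸ insert w C w~C
  insert-∈ w []      []             = here refl
  insert-∈ w (c ∷ C) (inj₁ _ ∷ _)   = here refl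
  insert-∈ w (c ∷ C) (inj₂ _ ∷ w~C) = there (insert-∈ w C w~C)

  insert-chain : ∀ w C w~C → Chain C → w ∉ᴸ C → Chain (insert w C w~C)
  insert-chain w []      []               []          _   = [] ∷ []
  insert-chain w (c ∷ C) (inj₁ w≤c ∷ _)   (c<C ∷ ch) w∉C = (w<c ∷ All.map (<-trans w<c) c<C) ∷ c<C ∷ ch
    where
    w<c : w < c
    w<c = w≤c , w∉C ∘ here
  insert-chain w (c ∷ C) (inj₂ c≤w ∷ w~C) (c<C ∷ ch) w∉C =
    All.tabulate c<insert ∷ insert-chain w C w~C ch (w∉C ∘ there)
    where
    c<insert : ∀ {u} → u ∈ᴸ insert w C w~C → c < u
    c<insert u∈ with ∈-insert⁻ w C w~C u∈
    ... | inj₁ refl = c≤w , λ { refl → w∉C (here refl) }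
    ... | inj₂ u∈C  = All.lookup c<C u∈C

  lookup-injective : ∀ {xs : List Elt} → AllPairs _≢_ xs → Injective _≡_ _≡_ (lookup xs)
  lookup-injective {x ∷ xs} (x≢xs ∷ _) {zero}  {zero}  _ = refl
  lookup-injective {x ∷ xs} (x≢xs ∷ _) {zero}  {suc j} e = ⊥-elim (All.lookup x≢xs (∈-lookup j) e)
  lookup-injective {x ∷ xs} (x≢xs ∷ _) {suc i} {zero}  e = ⊥-elim (All.lookup x≢xs (∈-lookup i) (sym e))
  lookup-injective {x ∷ xs} (_ ∷ u)    {suc i} {suc j} e = cong suc (lookup-injective u e)

  chain-length≤N : ∀ {C} → Chain C → length C ℕ.≤ N
  chain-length≤N ch = injective⇒≤ (lookup-injective (AllPairs.map proj₂ ch))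

  maximal-or-extendable : ∀ {C} → Chain C →
    ¬ ¬ (IsMaxChain C ⊎ ∃ λ w → w ∉ᴸ C × All (Comparable w) C)
  maximal-or-extendable {C} ch = ¬¬-map classify ¬¬-excluded-middle
    where
    classify : Dec (∃ λ w → w ∉ᴸ C × All (Comparable w) C) →
               IsMaxChain C ⊎ ∃ λ w → w ∉ᴸ C × All (Comparable w) C
    classify (yes extendable)  = inj₂ extendable
    classify (no ¬extendable) = inj₁ (AllPairs⇒Linked ch , maximal)
      where
      maximal : ∀ w → All (Comparable w) C → w ∈ᴸ C
      maximal w w~C with w ∈ᴸ? C
      ... | yes w∈C = w∈C
      ... | no  w∉C = ⊥-elim (¬extendable (w , w∉C , w~C))

  maxChain-⋖ : ∀ {M a v} → IsMaxChain M → a ∈ᴸ M → v ∈ᴸ M → a < v →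
               (∀ {u} → u ∈ᴸ M → a < u → u < v → ⊥) → a ⋖ v
  maxChain-⋖ {M} {a} {v} (linked , maximal) a∈M v∈M a<v gap = a<v , λ (w , a<w , w<v) →
    gap (maximal w (All.tabulate (comparable a<w w<v))) a<w w<v
    where
    comparable : ∀ {w u} → a < w → w < v → u ∈ᴸ M → Comparable w u
    comparable a<w w<v u∈M with chain-trichotomy (Linked⇒Chain linked) u∈M a∈M
    ... | inj₁ refl        = inj₂ (proj₁ a<w)
    ... | inj₂ (inj₁ u<a) = inj₂ (≤.trans (proj₁ u<a) (proj₁ a<w))
    ... | inj₂ (inj₂ a<u) with chain-trichotomy (Linked⇒Chain linked) u∈M v∈M
    ...   | inj₁ refl        = inj₁ (proj₁ w<v)
    ...   | inj₂ (inj₂ v<u) = inj₁ (≤.trans (proj₁ w<v) (proj₁ v<u))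
    ...   | inj₂ (inj₁ u<v) = ⊥-elim (gap u∈M a<u u<v)

  module _ {k} (rank : HasRank k) where

    -- Extend C greedily towards a maximal chain; fuel bounds the number of extensions by N.
    ¬¬-length≤ : ∀ fuel {C} → Chain C → N ℕ.≤ fuel ℕ.+ length C → ¬ ¬ (length C ℕ.≤ suc k)
    ¬¬-length≤ fuel {C} ch N≤ ¬bound =
      maximal-or-extendable ch [ ¬bound ∘ ℕ.≤-reflexive ∘ rank C , grow fuel N≤ ]′
      where
      grow : ∀ fuel → N ℕ.≤ fuel ℕ.+ length C → ¬ (∃ λ w → w ∉ᴸ C × All (Comparable w) C)
      grow zero N≤ (w , w∉C , w~C) = ℕ.<⇒≱ (subst (N ℕ.<_) (sym (length-insert w C w~C)) (ℕ.s≤s N≤))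
        (chain-length≤N (insert-chain w C w~C ch w∉C))
      grow (suc fuel) N≤ (w , w∉C , w~C) =
        ¬¬-length≤ fuel (insert-chain w C w~C ch w∉C)
          (subst (N ℕ.≤_) (trans (sym (ℕ.+-suc fuel _)) (cong (fuel ℕ.+_) (sym (length-insert w C w~C)))) N≤)
          (¬bound ∘ ℕ.≤-trans (ℕ.n≤1+n _) ∘ subst (ℕ._≤ suc k) (length-insert w C w~C))

    chain-length≤ : ∀ {C} → Chain C → length C ℕ.≤ suc k
    chain-length≤ {C} ch = decidable-stable (length C ℕ.≤? suc k) (¬¬-length≤ N ch (ℕ.m≤m+n N (length C)))

    module Exchange {M} (M-max : IsMaxChain M) {a c d} (a∈M : a ∈ᴸ M) (c∈M : c ∈ᴸ M) (d∈M : d ∈ᴸ M)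
                    (a⋖c : a ⋖ c) (c⋖d : c ⋖ d) where
      M-chain : Chain M
      M-chain = Linked⇒Chain (proj₁ M-max)

      M∖c : List Elt
      M∖c = filter (λ u → ¬? (u ≟ c)) M

      ∈-M∖c⁺ : ∀ {u} → u ∈ᴸ M → u ≢ c → u ∈ᴸ M∖c
      ∈-M∖c⁺ = ∈-filter⁺ (λ u → ¬? (u ≟ c))

      ∈-M∖c⁻ : ∀ {u} → u ∈ᴸ M∖c → u ∈ᴸ M × u ≢ c
      ∈-M∖c⁻ = ∈-filter⁻ (λ u → ¬? (u ≟ c))

      M∖c-chain : Chain M∖c
      M∖c-chain = AllPairsₚ.filter⁺ (λ u → ¬? (u ≟ c)) M-chain

      suc-k≤length-M∖c : suc k ℕ.≤ suc (length M∖c)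
      suc-k≤length-M∖c = ℕ.≤-trans (ℕ.≤-reflexive (sym (rank M M-max)))
                                   (length≤suc-length-filter (AllPairs.map proj₂ M-chain))
        where
        length≤suc-length-filter : ∀ {xs} → AllPairs _≢_ xs →
          length xs ℕ.≤ suc (length (filter (λ u → ¬? (u ≟ c)) xs))
        length≤suc-length-filter {[]}     []             = ℕ.z≤n
        length≤suc-length-filter {x ∷ xs} (x≢xs ∷ uniq) with x ≟ c
        ... | yes refl = ℕ.s≤s (ℕ.≤-reflexive (cong length (sym (filter-all _ (All.map (_∘ sym) x≢xs)))))
        ... | no  _    = ℕ.s≤s (length≤suc-length-filter uniq)

      M∖c-avoids-interval : ∀ {u} → u ∈ᴸ M∖c → u ≤ a ⊎ d ≤ u
      M∖c-avoids-interval {u} u∈M∖c with ∈-M∖c⁻ u∈M∖c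
      ... | u∈M , u≢c with chain-trichotomy M-chain u∈M a∈M
      ...   | inj₁ refl        = inj₁ ≤.refl
      ...   | inj₂ (inj₁ u<a) = inj₁ (proj₁ u<a)
      ...   | inj₂ (inj₂ a<u) with chain-trichotomy M-chain u∈M d∈M
      ...     | inj₁ refl        = inj₂ ≤.refl
      ...     | inj₂ (inj₂ d<u) = inj₂ (proj₁ d<u)
      ...     | inj₂ (inj₁ u<d) with chain-trichotomy M-chain u∈M c∈M
      ...       | inj₁ u≡c        = ⊥-elim (u≢c u≡c)
      ...       | inj₂ (inj₁ u<c) = ⊥-elim (proj₂ a⋖c (u , a<u , u<c))
      ...       | inj₂ (inj₂ c<u) = ⊥-elim (proj₂ c⋖d (u , c<u , u<d))

      module _ {v} (a<v : a < v) (v<d : v < d) where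
        v~M∖c : All (Comparable v) M∖c
        v~M∖c = All.tabulate λ u∈ → [ (λ u≤a → inj₂ (≤.trans u≤a (proj₁ a<v)))
                                    , (λ d≤u → inj₁ (≤.trans (proj₁ v<d) d≤u)) ]′ (M∖c-avoids-interval u∈)

        v∉M∖c : v ∉ᴸ M∖c
        v∉M∖c v∈ = [ <⇒≱ a<v , <⇒≱ v<d ]′ (M∖c-avoids-interval v∈)

        M[c≔v] : List Elt
        M[c≔v] = insert v M∖c v~M∖c

        M[c≔v]-chain : Chain M[c≔v]
        M[c≔v]-chain = insert-chain v M∖c v~M∖c M∖c-chain v∉M∖c

        M[c≔v]-maximal : IsMaxChain M[c≔v]
        M[c≔v]-maximal = AllPairs⇒Linked M[c≔v]-chain , maximal
          where
          too-long : ∀ {w} → w ∉ᴸ M[c≔v] → All (Comparable w) M[c≔v] → ⊥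
          too-long {w} w∉ w~ =
            ℕ.<⇒≱ (ℕ.s≤s (subst (suc k ℕ.≤_) (sym (length-insert v M∖c v~M∖c)) suc-k≤length-M∖c))
            (subst (ℕ._≤ suc k) (length-insert w M[c≔v] w~) (chain-length≤ (insert-chain w M[c≔v] w~ M[c≔v]-chain w∉)))
          maximal : ∀ w → All (Comparable w) M[c≔v] → w ∈ᴸ M[c≔v]
          maximal w w~ with w ∈ᴸ? M[c≔v]
          ... | yes w∈ = w∈
          ... | no  w∉ = ⊥-elim (too-long w∉ w~)

        ∈-M[c≔v]⁺ : ∀ {u} → u ∈ᴸ M → u ≢ c → u ∈ᴸ M[c≔v]
        ∈-M[c≔v]⁺ u∈M u≢c = ∈-insert⁺ v M∖c v~M∖c (∈-M∖c⁺ u∈M u≢c)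

        v∈M[c≔v] : v ∈ᴸ M[c≔v]
        v∈M[c≔v] = insert-∈ v M∖c v~M∖c

        nothing-strictly-between : ∀ {u} → u ∈ᴸ M[c≔v] → a < u → u < d → u ≡ v
        nothing-strictly-between u∈ a<u u<d with ∈-insert⁻ v M∖c v~M∖c u∈
        ... | inj₁ u≡v  = u≡v
        ... | inj₂ u∈M∖c = ⊥-elim ([ <⇒≱ a<u , <⇒≱ u<d ]′ (M∖c-avoids-interval u∈M∖c))

        a⋖v : a ⋖ v
        a⋖v = maxChain-⋖ M[c≔v]-maximal (∈-M[c≔v]⁺ a∈M (proj₂ (proj₁ a⋖c))) v∈M[c≔v] a<v
          λ u∈ a<u u<v → proj₂ u<v (nothing-strictly-between u∈ a<u (<-trans u<v v<d))

        v⋖d : v ⋖ d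
        v⋖d = maxChain-⋖ M[c≔v]-maximal v∈M[c≔v] (∈-M[c≔v]⁺ d∈M (proj₂ (proj₁ c⋖d) ∘ sym)) v<d
          λ u∈ v<u u<d → proj₂ v<u (sym (nothing-strictly-between u∈ (<-trans a<v v<u) u<d))

  CoverSeq-++⁻ : ∀ {x y} pre {rest} → CoverSeq x (pre ++ rest) y →
                 ∃ λ a → CoverSeq x pre a × CoverSeq a rest y
  CoverSeq-++⁻ {x} []        x⇝y         = x , refl , x⇝y
  CoverSeq-++⁻     (z ∷ pre) (x⋖z , z⇝y) =
    let a , z⇝a , a⇝y = CoverSeq-++⁻ pre z⇝y in a , (x⋖z , z⇝a) , a⇝y

  CoverSeq-++⁺ : ∀ {x a y} pre {rest} → CoverSeq x pre a → CoverSeq a rest y → CoverSeq x (pre ++ rest) y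
  CoverSeq-++⁺ []        refl        a⇝y = a⇝y
  CoverSeq-++⁺ (z ∷ pre) (x⋖z , z⇝a) a⇝y = x⋖z , CoverSeq-++⁺ pre z⇝a a⇝y

  CoverSeq⇒≤end : ∀ {x a} zs → CoverSeq x zs a → All (_≤ a) (x ∷ zs)
  CoverSeq⇒≤end []       refl              = ≤.refl ∷ []
  CoverSeq⇒≤end (z ∷ zs) ((x<z , _) , z⇝a) with CoverSeq⇒≤end zs z⇝a
  ... | z≤a ∷ zs≤a = ≤.trans (proj₁ x<z) z≤a ∷ z≤a ∷ zs≤a

  CoverSeq⇒start< : ∀ {x y} zs → CoverSeq x zs y → All (x <_) zs
  CoverSeq⇒start< []       _                 = []
  CoverSeq⇒start< (z ∷ zs) ((x<z , _) , z⇝y) = x<z ∷ All.map (<-trans x<z) (CoverSeq⇒start< zs z⇝y)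

  CoverSeq-end∈ : ∀ {x a} zs → CoverSeq x zs a → a ∈ᴸ x ∷ zs
  CoverSeq-end∈ []       refl        = here refl
  CoverSeq-end∈ (z ∷ zs) (_ , z⇝a)   = there (CoverSeq-end∈ zs z⇝a)

  CoverSeq-distinct : ∀ {x y} pre c rest → CoverSeq x (pre ++ c ∷ rest) y → All (_≢ c) (x ∷ pre) × All (_≢ c) rest
  CoverSeq-distinct pre c rest x⇝y with CoverSeq-++⁻ pre x⇝y
  ... | _ , x⇝a , (a<c , _) , c⇝y = All.map (λ u≤a → proj₂ (≤-<-trans u≤a a<c)) (CoverSeq⇒≤end pre x⇝a)
                                  , All.map (λ c<u → proj₂ c<u ∘ sym) (CoverSeq⇒start< rest c⇝y)

module PolytopalDiamond (P : FinBoundedPoset) where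
  open FinBoundedPoset P
  open Chains P

  -- face-diamond is only classical (¬¬), but the sought element ranges over the finite P.
  polytopal-diamond : ∀ {S} → IsPolytopal S → ∀ {a z d} → a ∈ S → z ∈ S → d ∈ S → a < z → z < d →
                      ∃ λ e → e ∈ S × a < e × e < d × e ≢ z
  polytopal-diamond {S} (F , _ , _ , V , f , face , injective , surjective , order-iso) {a} {z} {d}
                    a∈S z∈S d∈S (a≤z , a≢z) (z≤d , z≢d) =
    fromCandidate (decidable-stable (any? candidate?) (¬¬-map toCandidate
      (face-diamond (face a a∈S) (face z z∈S) (face d d∈S) (⊆∧≢⇒⊂ fa⊆fz fa≢fz) (⊆∧≢⇒⊂ fz⊆fd fz≢fd))))
    where
    open FaceGeometry F V using (face-diamond)
    fa⊆fz = proj₁ (order-iso a z a∈S z∈S) a≤z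
    fz⊆fd = proj₁ (order-iso z d z∈S d∈S) z≤d
    fa≢fz = a≢z ∘ injective a z a∈S z∈S
    fz≢fd = z≢d ∘ injective z d z∈S d∈S

    Candidate : Pred Elt 0ℓ
    Candidate e = e ∈ S × f a ⊆ f e × f e ⊆ f d × e ≢ a × e ≢ d × e ≢ z

    candidate? : Decidable Candidate
    candidate? e = (e ∈? S) ×-dec (f a ⊆? f e) ×-dec (f e ⊆? f d)
                   ×-dec ¬? (e ≟ a) ×-dec ¬? (e ≟ d) ×-dec ¬? (e ≟ z)

    toCandidate : (∃ λ T → Polytope.IsFace F V T × f a ⊆ T × T ⊆ f d × T ⊈ f z × f z ⊈ T) → ∃ Candidate
    toCandidate (T , φ , fa⊆T , T⊆fd , T⊈fz , fz⊈T) with surjective T φ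
    ... | e , e∈S , refl = e , e∈S , fa⊆T , T⊆fd
                         , (λ { refl → T⊈fz fa⊆fz }) , (λ { refl → fz⊈T fz⊆fd })
                         , (λ { refl → T⊈fz (λ i∈ → i∈) })

    fromCandidate : ∃ Candidate → ∃ λ e → e ∈ S × a < e × e < d × e ≢ z
    fromCandidate (e , e∈S , fa⊆fe , fe⊆fd , e≢a , e≢d , e≢z) =
      e , e∈S , (proj₂ (order-iso a e a∈S e∈S) fa⊆fe , e≢a ∘ sym)
            , (proj₂ (order-iso e d e∈S d∈S) fe⊆fd , e≢d) , e≢z

module LabelProperties (P : FinBoundedPoset) (L : Poset 0ℓ 0ℓ 0ℓ)
                       (lab : List (Fin (FinBoundedPoset.N P)) → Fin (FinBoundedPoset.N P) → Poset.Carrier L) where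
  open FinBoundedPoset P using (N)
  open Chains P
  open Labelled P L lab
  open Poset L using () renaming (_≤_ to _⊑_)

  Ascent : List Elt → Elt → Elt → Set
  Ascent ρ c d = lab ρ c ⊑ lab (ρ ++ c ∷ []) d

  labels-++ : ∀ ρ xs ys → labels ρ (xs ++ ys) ≡ labels ρ xs ++ labels (ρ ++ xs) ys
  labels-++ ρ []       ys = cong (λ ρ′ → labels ρ′ ys) (sym (++-identityʳ ρ))
  labels-++ ρ (z ∷ xs) ys = cong (lab ρ z ∷_) (trans (labels-++ (ρ ++ z ∷ []) xs ys)
    (cong (λ ρ′ → labels (ρ ++ z ∷ []) xs ++ labels ρ′ ys) (++-assoc ρ (z ∷ []) xs)))

  LexLt-++ʳ : ∀ {u v} p q → LexLt u v → LexLt (u ++ p) (v ++ q)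
  LexLt-++ʳ p q (here u₀⊏v₀)       = here u₀⊏v₀
  LexLt-++ʳ p q (there u₀≈v₀ u<v) = there u₀≈v₀ (LexLt-++ʳ p q u<v)

  LexLt-++ˡ : ∀ {u v} p → LexLt u v → LexLt (p ++ u) (p ++ v)
  LexLt-++ˡ []      u<v = u<v
  LexLt-++ˡ (_ ∷ p) u<v = there (Poset.Eq.refl L) (LexLt-++ˡ p u<v)

  LexLt-labels-++ : ∀ ρ pre {us vs} → LexLt (labels (ρ ++ pre) us) (labels (ρ ++ pre) vs) →
                    LexLt (labels ρ (pre ++ us)) (labels ρ (pre ++ vs))
  LexLt-labels-++ ρ pre us<vs = subst₂ LexLt (sym (labels-++ ρ pre _)) (sym (labels-++ ρ pre _))
                                      (LexLt-++ˡ (labels ρ pre) us<vs)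

  module LengthTwo (cl : IsCLLabeling) {ρ a c d} (root : IsRoot ρ a) (a⋖c : a ⋖ c) (c⋖d : c ⋖ d)
                   (ascent : Ascent ρ c d) where
    open ChainProperties P using (<-trans)

    private
      cl[a,d] = cl a d ρ root (proj₁ (<-trans (proj₁ a⋖c) (proj₁ c⋖d)))
      increasing = proj₁ cl[a,d]
      increasing-unique = proj₁ (proj₂ (proj₂ (proj₂ cl[a,d])))
      increasing-lexFirst = proj₂ (proj₂ (proj₂ (proj₂ cl[a,d])))

      c∷d≡increasing : c ∷ d ∷ [] ≡ increasing
      c∷d≡increasing = increasing-unique _ (a⋖c , c⋖d , refl) (ascent ∷ [-])

    ascent-unique : ∀ {v} → a ⋖ v → v ⋖ d → Ascent ρ v d → v ≡ c
    ascent-unique a⋖v v⋖d v-ascent =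
      ∷-injectiveˡ (trans (increasing-unique _ (a⋖v , v⋖d , refl) (v-ascent ∷ [-])) (sym c∷d≡increasing))

    ascent-lexFirst : ∀ {v} → a ⋖ v → v ⋖ d → v ≢ c → LexLt (labels ρ (c ∷ d ∷ [])) (labels ρ (v ∷ d ∷ []))
    ascent-lexFirst a⋖v v⋖d v≢c = subst (λ zs → LexLt (labels ρ zs) (labels ρ (_ ∷ d ∷ []))) (sym c∷d≡increasing)
      (increasing-lexFirst _ (a⋖v , v⋖d , refl) (v≢c ∘ ∷-injectiveˡ ∘ flip trans (sym c∷d≡increasing)))

module CLcedExchange (P : FinBoundedPoset) (k : ℕ) (rank : Chains.HasRank P k) (L : Poset 0ℓ 0ℓ 0ℓ)
                     (lab : List (Fin (FinBoundedPoset.N P)) → Fin (FinBoundedPoset.N P) → Poset.Carrier L)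
                     (cl : Labelled.IsCLLabeling P L lab)
                     (m : ℕ) (Σs : Fin m → Subset (FinBoundedPoset.N P))
                     (ced : Labelled.CED.IsCLced P L lab k m Σs) where
  open FinBoundedPoset P
  open Chains P
  open ChainProperties P
  open PolytopalDiamond P
  open Labelled P L lab
  open LabelProperties P L lab
  open CED k m Σs
  open IsCLced ced using (polytope; desc)

  module _ {s M} (genM : Gen s M) {ρ a c d} (root : IsRoot ρ a)
           (a∈M : a ∈ᴸ M) (c∈M : c ∈ᴸ M) (d∈M : d ∈ᴸ M)
           (a⋖c : a ⋖ c) (c⋖d : c ⋖ d) (ascent : Ascent ρ c d) where
    open Exchange rank (proj₁ genM) a∈M c∈M d∈M a⋖c c⋖d
    open LengthTwo cl root a⋖c c⋖d ascent

    a≢c : a ≢ c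
    a≢c = proj₂ (proj₁ a⋖c)

    d≢c : d ≢ c
    d≢c = proj₂ (proj₁ c⋖d) ∘ sym

    -- LiesIn t v: the exchanged chain M[c≔v] lies in Σ_t.
    LiesIn : Fin m → Elt → Set
    LiesIn t v = v ∈ Σs t × All (_∈ Σs t) M∖c

    Detour : Fin m → Set
    Detour t = ∃ λ v → Σ (a < v) λ a<v → Σ (v < d) λ v<d → LiesIn t v

    LiesIn⇒All : ∀ {t v} (a<v : a < v) (v<d : v < d) → LiesIn t v → All (_∈ Σs t) (M[c≔v] a<v v<d)
    LiesIn⇒All a<v v<d (v∈Σ , M∖c⊆Σ) = All.tabulate λ u∈ →
      [ (λ { refl → v∈Σ }) , All.lookup M∖c⊆Σ ]′ (∈-insert⁻ _ M∖c (v~M∖c a<v v<d) u∈)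

    All⇒LiesIn : ∀ {t v} (a<v : a < v) (v<d : v < d) → All (_∈ Σs t) (M[c≔v] a<v v<d) → LiesIn t v
    All⇒LiesIn a<v v<d M[c≔v]⊆Σ = All.lookup M[c≔v]⊆Σ (v∈M[c≔v] a<v v<d)
                                 , All.tabulate (All.lookup M[c≔v]⊆Σ ∘ ∈-insert⁺ _ M∖c (v~M∖c a<v v<d))

    All-M∖c⇒All-M : ∀ {t} → c ∈ Σs t → All (_∈ Σs t) M∖c → All (_∈ Σs t) M
    All-M∖c⇒All-M {t} c∈Σ M∖c⊆Σ = All.tabulate u∈Σ
      where
      u∈Σ : ∀ {u} → u ∈ᴸ M → u ∈ Σs t
      u∈Σ {u} u∈M with u ≟ c
      ... | yes refl = c∈Σ
      ... | no  u≢c  = All.lookup M∖c⊆Σ (∈-M∖c⁺ u∈M u≢c)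

    generates : ∀ {t v} (a<v : a < v) (v<d : v < d) → (∀ {t′} → t′ <ᶠ t → ¬ Detour t′) →
                LiesIn t v → Gen t (M[c≔v] a<v v<d)
    generates a<v v<d no-earlier inΣ = M[c≔v]-maximal a<v v<d , LiesIn⇒All a<v v<d inΣ
                                     , λ t′ t′<t ⊆Σt′ → no-earlier t′<t (_ , a<v , v<d , All⇒LiesIn a<v v<d ⊆Σt′)

    interval-face : ∀ {t v} (a<v : a < v) (v<d : v < d) → Gen t (M[c≔v] a<v v<d) → FaceΔ t (a ∷ v ∷ d ∷ [])
    interval-face a<v v<d gen = _ , gen , ∈-M[c≔v]⁺ a<v v<d a∈M a≢c ∷ v∈M[c≔v] a<v v<d
                                        ∷ ∈-M[c≔v]⁺ a<v v<d d∈M d≢c ∷ []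

    -- For the least t with a detour, the diamond of Σ_t gives two exchanges generating Δ_t,
    -- both descending on [a, d]_ρ since c ∉ Σ_t; (desc) makes them equal.
    no-detour-below : ∀ t → t <ᶠ s → ¬ Detour t
    no-detour-below = WellFounded.All.wfRec <ᶠ-wellFounded 0ℓ _ step
      where
      step : ∀ t → (∀ {t′} → t′ <ᶠ t → t′ <ᶠ s → ¬ Detour t′) → t <ᶠ s → ¬ Detour t
      step t earlier t<s (z , a<z , z<d , z∈Σ , M∖c⊆Σ) =
        let e , e∈Σ , a<e , e<d , e≢z = polytopal-diamond (polytope t) (inΣ a∈M a≢c) z∈Σ (inΣ d∈M d≢c) a<z z<d
        in e≢z (sym (∷-injectiveˡ (desc t a d ρ root (z ∷ d ∷ []) (e ∷ d ∷ []) (covers a<z z<d) (covers a<e e<d)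
                                        (descending a<z z<d z∈Σ) (descending a<e e<d e∈Σ)
                                        (face a<z z<d z∈Σ) (face a<e e<d e∈Σ))))
        where
        inΣ : ∀ {u} → u ∈ᴸ M → u ≢ c → u ∈ Σs t
        inΣ u∈M u≢c = All.lookup M∖c⊆Σ (∈-M∖c⁺ u∈M u≢c)
        c∉Σ : c ∉ Σs t
        c∉Σ c∈Σ = proj₂ (proj₂ genM) t t<s (All-M∖c⇒All-M c∈Σ M∖c⊆Σ)
        covers : ∀ {v} (a<v : a < v) (v<d : v < d) → CoverSeq a (v ∷ d ∷ []) d
        covers a<v v<d = a⋖v a<v v<d , v⋖d a<v v<d , refl
        descending : ∀ {v} (a<v : a < v) (v<d : v < d) → v ∈ Σs t → DescendingLabels (labels ρ (v ∷ d ∷ []))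
        descending a<v v<d v∈Σ =
          (λ v-ascent → c∉Σ (subst (_∈ Σs t) (ascent-unique (a⋖v a<v v<d) (v⋖d a<v v<d) v-ascent) v∈Σ)) ∷ [-]
        face : ∀ {v} (a<v : a < v) (v<d : v < d) → v ∈ Σs t → FaceΔ t (a ∷ v ∷ d ∷ [])
        face a<v v<d v∈Σ = interval-face a<v v<d (generates a<v v<d (λ t′<t → earlier t′<t (Fin.<-trans t′<t t<s))
                                                             (v∈Σ , M∖c⊆Σ))

    exchange : ∃ λ e → a ⋖ e × e ⋖ d × ¬ Ascent ρ e d ×
               LexLt (labels ρ (c ∷ d ∷ [])) (labels ρ (e ∷ d ∷ [])) ×
               ∃ λ M′ → Gen s M′ × e ∈ᴸ M′ × (∀ {u} → u ∈ᴸ M → u ≢ c → u ∈ᴸ M′)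
    exchange =
      let e , e∈Σ , a<e , e<d , e≢c = polytopal-diamond (polytope s) (All.lookup M⊆Σ a∈M) (All.lookup M⊆Σ c∈M)
                                                         (All.lookup M⊆Σ d∈M) (proj₁ a⋖c) (proj₁ c⋖d)
      in e , a⋖v a<e e<d , v⋖d a<e e<d , e≢c ∘ ascent-unique (a⋖v a<e e<d) (v⋖d a<e e<d)
         , ascent-lexFirst (a⋖v a<e e<d) (v⋖d a<e e<d) e≢c
         , M[c≔v] a<e e<d , generates a<e e<d (no-detour-below _) (e∈Σ , Allₚ.filter⁺ (λ u → ¬? (u ≟ c)) M⊆Σ)
         , v∈M[c≔v] a<e e<d , ∈-M[c≔v]⁺ a<e e<d
      where
      M⊆Σ = proj₁ (proj₂ genM)

lemma2p7 : (P : FinBoundedPoset) (k : ℕ) → Chains.HasRank P k →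
    (L : Poset 0ℓ 0ℓ 0ℓ) →
    (lab : List (Fin (FinBoundedPoset.N P)) → Fin (FinBoundedPoset.N P) → Poset.Carrier L) →
    Labelled.IsCLLabeling P L lab →
    (m : ℕ) (Σs : Fin m → Subset (FinBoundedPoset.N P)) →
    Labelled.CED.IsCLced P L lab k m Σs →
    (s : Fin m) (x y : Fin (FinBoundedPoset.N P)) (ρ : List (Fin (FinBoundedPoset.N P))) →
    Chains.IsRoot P ρ x →
    (pre post : List (Fin (FinBoundedPoset.N P))) (ci d : Fin (FinBoundedPoset.N P)) →
    Chains.CoverSeq P x (pre ++ ci ∷ d ∷ post) y →
    Labelled.CED.FaceΔ P L lab k m Σs s (x ∷ pre ++ ci ∷ d ∷ post) →
    Poset._≤_ L (lab (ρ ++ pre) ci) (lab ((ρ ++ pre) ++ ci ∷ []) d) →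
    ∃ λ ci″ →
      Chains.CoverSeq P x (pre ++ ci″ ∷ d ∷ post) y ×
      Labelled.CED.FaceΔ P L lab k m Σs s (x ∷ pre ++ ci″ ∷ d ∷ post) ×
      ¬ Poset._≤_ L (lab (ρ ++ pre) ci″) (lab ((ρ ++ pre) ++ ci″ ∷ []) d) ×
      Labelled.LexLt P L lab (Labelled.labels P L lab ρ (pre ++ ci ∷ d ∷ post))
                             (Labelled.labels P L lab ρ (pre ++ ci″ ∷ d ∷ post))
lemma2p7 P k rank L lab cl m Σs ced s x y ρ root pre post c d x⇝y (M , genM , chain⊆M) ascent =
  let a , x⇝a , a⋖c , c⋖d , d⇝y = CoverSeq-++⁻ P pre x⇝y
      e , a⋖e , e⋖d , descent , lexLater , M′ , genM′ , e∈M′ , M∖c⊆M′ =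
        exchange genM (CoverSeq-++⁺ P ρ root x⇝a) (All.lookup below (CoverSeq-end∈ P pre x⇝a))
                 (All.head above) (All.head (All.tail above)) a⋖c c⋖d ascent
  in e , CoverSeq-++⁺ P pre x⇝a (a⋖e , e⋖d , d⇝y)
       , (M′ , genM′ , Allₚ.++⁺ (All.zipWith (uncurry M∖c⊆M′) (below , proj₁ distinct))
                                (e∈M′ ∷ All.zipWith (uncurry M∖c⊆M′) (All.tail above , proj₂ distinct)))
       , descent
       , LexLt-labels-++ P L lab ρ pre (LexLt-++ʳ P L lab _ _ lexLater)
  where
  open ChainProperties using (CoverSeq-++⁻; CoverSeq-++⁺; CoverSeq-end∈; CoverSeq-distinct)
  open LabelProperties using (LexLt-labels-++; LexLt-++ʳ)
  open CLcedExchange P k rank L lab cl m Σs ced using (exchange)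
  below = Allₚ.++⁻ˡ (x ∷ pre) chain⊆M
  above = Allₚ.++⁻ʳ (x ∷ pre) chain⊆M
  distinct = CoverSeq-distinct P pre c (d ∷ post) x⇝y
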